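{- For every positive integer $n$, the total number of combining moves made in a complete generalized Zeckendorf game on $n$ is the same for all complete games on $n$ (independent of how the game is played).
   Context: Let $a_1=1$, $a_2=2$ and $a_{i+1}=i\,a_i+a_{i-1}$ for $i\ge 2$. The generalized Zeckendorf game on $n$: the state is a multiset of terms of the sequence, initially $n$ copies of $a_1=1$. A move is one of: (combining) replace two $1$'s by one $2$; or, for $i\ge 2$, if the multiset contains at least $i$ copies of $a_i$ and at least one $a_{i-1}$, replace $i$ copies of $a_i$ and one $a_{i-1}$ by one $a_{i+1}$; (splitting) if it contains three $2$'s, replace them by one $1$ and one $5$; or, for $i\ge 3$, if it contains $i+1$ copies of $a_i$, replace them by one $a_{i+1}$, $i-2$ copies of $a_{i-1}$ and one $a_{i-2}$. The game ends when no move is available. A complete game is a sequence of legal moves from the initial state to a state with no available move. -}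

module Defs where

open import Data.Nat using (ℕ; zero; suc; _+_; _∸_; _≤_; _≥_; _≡ᵇ_)
open import Data.Bool using (if_then_else_)
open import Data.List using (List; []; _∷_)
open import Data.Product using (Σ; _×_)
open import Relation.Nullary using (¬_)

-- The sequence a_1 = 1, a_2 = 2, a_{i+1} = i a_i + a_{i-1}  (index 0 unused).
a : ℕ → ℕ
a 0 = 0
a 1 = 1
a 2 = 2
a (suc (suc (suc i))) = suc (suc i) * a (suc (suc i)) + a (suc i)
  where open import Data.Nat using (_*_)

-- A game state is a multiset of terms of the sequence; since the terms
-- a_1 < a_2 < ... are distinct, it is given by multiplicities:
-- (s i) = number of copies of a_i in the multiset (i ≥ 1; s 0 is unused).
State : Set
State = ℕ → ℕ

initial : ℕ → State
initial n j = if j ≡ᵇ 1 then n else 0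

combine1 : State → State
combine1 s j =
  if j ≡ᵇ 1 then s 1 ∸ 2 else
  if j ≡ᵇ 2 then suc (s 2) else s j

combineI : ℕ → State → State
combineI i s j =
  if j ≡ᵇ i then s i ∸ i else
  if j ≡ᵇ (i ∸ 1) then s (i ∸ 1) ∸ 1 else
  if j ≡ᵇ suc i then suc (s (suc i)) else s j

split2 : State → State
split2 s j =
  if j ≡ᵇ 2 then s 2 ∸ 3 else
  if j ≡ᵇ 1 then suc (s 1) else
  if j ≡ᵇ 3 then suc (s 3) else s j

splitI : ℕ → State → State
splitI i s j =
  if j ≡ᵇ i then s i ∸ suc i else
  if j ≡ᵇ suc i then suc (s (suc i)) else
  if j ≡ᵇ (i ∸ 1) then s (i ∸ 1) + (i ∸ 2) else
  if j ≡ᵇ (i ∸ 2) then suc (s (i ∸ 2)) else s j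

data Kind : Set where
  combining splitting : Kind

data Move : Kind → State → State → Set where
  comb1  : ∀ {s} → s 1 ≥ 2 → Move combining s (combine1 s)
  combI  : ∀ {s} i → i ≥ 2 → s i ≥ i → s (i ∸ 1) ≥ 1 →
           Move combining s (combineI i s)
  split2′ : ∀ {s} → s 2 ≥ 3 → Move splitting s (split2 s)
  splitI′ : ∀ {s} i → i ≥ 3 → s i ≥ suc i → Move splitting s (splitI i s)

Terminal : State → Set
Terminal s = ∀ k t → ¬ Move k s t

data Run : State → State → List Kind → Set where
  done : ∀ {s} → Run s s []
  step : ∀ {s t u k ks} → Move k s t → Run t u ks → Run s u (k ∷ ks)

combiningCount : List Kind → ℕ
combiningCount [] = 0
combiningCount (combining ∷ ks) = suc (combiningCount ks)
combiningCount (splitting ∷ ks) = combiningCount ks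

CompleteGame : ℕ → List Kind → Set
CompleteGame n ks = Σ State (λ t → Run (initial n) t ks × Terminal t)

{-# OPTIONS --safe #-}
-- The value Σ a_j s_j is
-- preserved by every move.  The cost Σ b_j s_j, where b_j is the number of combining
-- moves needed to build one a_j out of ones, grows by exactly one with each combining
-- move and is unchanged by splitting moves.  A terminal state has digits s_j ≤ j, and
-- s_(j-1) = 0 whenever s_j = j; as in a mixed-radix numeration such digits are
-- determined by their value.  Hence every complete game on n ends in the same state,
-- and the number of its combining moves is the cost of that state.
module Submission where

open import Defs
open import Algebra.Properties.CommutativeSemigroup using (interchange)
open import Data.Bool using (true; false; if_then_else_)
open import Data.List using (List)
open import Data.Nat
open import Data.Nat.Properties
open import Data.Nat.Tactic.RingSolver using (solve-∀)
open import Data.Product using (_×_; _,_; proj₁; proj₂)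
open import Data.Sum using ([_,_])
open import Function using (_∘_)
open import Relation.Binary using (tri<; tri≈; tri>)
open import Relation.Binary.PropositionalEquality
  using (_≡_; _≗_; refl; sym; trans; cong; cong₂; module ≡-Reasoning)
open import Relation.Nullary using (contradiction; yes; no)
open import Relation.Nullary.Decidable using (proof)
open import Relation.Nullary.Reflects using (Reflects; ofʸ; ofⁿ)

-- Index 0 is included; states never use it and both weights below vanish there.
weightedSum : (ℕ → ℕ) → ℕ → State → ℕ
weightedSum w zero    s = 0
weightedSum w (suc L) s = w L * s L + weightedSum w L s

_⊕_ : State → State → State
(s ⊕ t) j = s j + t j

single : ℕ → ℕ → State
single p x j = if j ≡ᵇ p then x else 0

≡ᵇ-reflects : ∀ m n → Reflects (m ≡ n) (m ≡ᵇ n)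
≡ᵇ-reflects m n = proof (m ≟ n)

weightedSum-cong : ∀ w L {s t} → (∀ {j} → j < L → w j * s j ≡ w j * t j) →
                   weightedSum w L s ≡ weightedSum w L t
weightedSum-cong w zero    eq = refl
weightedSum-cong w (suc L) eq = cong₂ _+_ (eq ≤-refl) (weightedSum-cong w L (eq ∘ m<n⇒m<1+n))

weightedSum-⊕ : ∀ w L s t → weightedSum w L (s ⊕ t) ≡ weightedSum w L s + weightedSum w L t
weightedSum-⊕ w zero    s t = refl
weightedSum-⊕ w (suc L) s t = begin
  w L * (s L + t L) + weightedSum w L (s ⊕ t)
    ≡⟨ cong₂ _+_ (*-distribˡ-+ (w L) (s L) (t L)) (weightedSum-⊕ w L s t) ⟩
  (w L * s L + w L * t L) + (weightedSum w L s + weightedSum w L t)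
    ≡⟨ interchange +-commutativeSemigroup (w L * s L) (w L * t L) (weightedSum w L s) _ ⟩
  (w L * s L + weightedSum w L s) + (w L * t L + weightedSum w L t) ∎
  where open ≡-Reasoning

weightedSum-single-outside : ∀ w {L p} x → L ≤ p → weightedSum w L (single p x) ≡ 0
weightedSum-single-outside w {zero}  x L≤p = refl
weightedSum-single-outside w {suc L} {p} x L<p with L ≡ᵇ p | ≡ᵇ-reflects L p
... | true  | ofʸ refl = contradiction L<p (<-irrefl refl)
... | false | ofⁿ _    = cong₂ _+_ (*-zeroʳ (w L)) (weightedSum-single-outside w x (<⇒≤ L<p))

weightedSum-single : ∀ w {L p} x → p < L → weightedSum w L (single p x) ≡ w p * x
weightedSum-single w {suc L} {p} x p<1+L with L ≡ᵇ p | ≡ᵇ-reflects L p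
... | true  | ofʸ refl = trans (cong (w L * x +_) (weightedSum-single-outside w {L} x ≤-refl)) (+-identityʳ _)
... | false | ofⁿ L≢p = cong₂ _+_ (*-zeroʳ (w L)) (weightedSum-single w x p<L)
  where
  p<L : p < L
  p<L = ≤∧≢⇒< (≤-pred p<1+L) (L≢p ∘ sym)

m∸n+n≡m+0 : ∀ {m n} → n ≤ m → m ∸ n + n ≡ m + 0
m∸n+n≡m+0 n≤m = trans (m∸n+n≡m n≤m) (sym (+-identityʳ _))

1+m+0≡m+1 : ∀ m → suc m + 0 ≡ m + 1
1+m+0≡m+1 m = trans (+-identityʳ (suc m)) (+-comm 1 m)

removed : ∀ {k s t} → Move k s t → State
removed (comb1 _)          = single 1 2
removed (combI i _ _ _)    = single (i ∸ 1) 1 ⊕ single i i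
removed (split2′ _)        = single 2 3
removed (splitI′ i _ _)    = single i (suc i)

added : ∀ {k s t} → Move k s t → State
added (comb1 _)          = single 2 1
added (combI i _ _ _)    = single (suc i) 1
added (split2′ _)        = single 1 1 ⊕ single 3 1
added (splitI′ i _ _)    = single (suc i) 1 ⊕ (single (i ∸ 1) (i ∸ 2) ⊕ single (i ∸ 2) 1)

-- Stated additively to avoid truncated subtraction.
move-replaces : ∀ {k s t} (mv : Move k s t) → t ⊕ removed mv ≗ s ⊕ added mv
move-replaces (comb1 h) 0 = refl
move-replaces (comb1 h) 1 = m∸n+n≡m+0 h
move-replaces {s = s} (comb1 h) 2 = 1+m+0≡m+1 (s 2)
move-replaces (comb1 h) (suc (suc (suc j))) = refl
move-replaces {s = s} (combI (suc (suc m)) (s≤s (s≤s z≤n)) h₁ h₂) j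
  with j ≡ᵇ 2 + m | ≡ᵇ-reflects j (2 + m)
     | j ≡ᵇ 1 + m | ≡ᵇ-reflects j (1 + m)
     | j ≡ᵇ 3 + m | ≡ᵇ-reflects j (3 + m)
... | true  | ofʸ refl | true  | ofʸ ()   | _     | _
... | true  | ofʸ refl | false | _        | true  | ofʸ ()
... | true  | ofʸ refl | false | _        | false | _        = m∸n+n≡m+0 h₁
... | false | _        | true  | ofʸ refl | true  | ofʸ ()
... | false | _        | true  | ofʸ refl | false | _        = m∸n+n≡m+0 h₂
... | false | _        | false | _        | true  | ofʸ refl = 1+m+0≡m+1 (s j)
... | false | _        | false | _        | false | _        = refl
move-replaces (split2′ h) 0 = refl
move-replaces {s = s} (split2′ h) 1 = 1+m+0≡m+1 (s 1)
move-replaces (split2′ h) 2 = m∸n+n≡m+0 h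
move-replaces {s = s} (split2′ h) 3 = 1+m+0≡m+1 (s 3)
move-replaces (split2′ h) (suc (suc (suc (suc j)))) = refl
move-replaces {s = s} (splitI′ (suc (suc (suc m))) (s≤s (s≤s (s≤s z≤n))) h) j
  with j ≡ᵇ 3 + m | ≡ᵇ-reflects j (3 + m)
     | j ≡ᵇ 4 + m | ≡ᵇ-reflects j (4 + m)
     | j ≡ᵇ 2 + m | ≡ᵇ-reflects j (2 + m)
     | j ≡ᵇ 1 + m | ≡ᵇ-reflects j (1 + m)
... | true  | ofʸ refl | true  | ofʸ ()   | _     | _        | _     | _
... | true  | ofʸ refl | false | _        | true  | ofʸ ()   | _     | _
... | true  | ofʸ refl | false | _        | false | _        | true  | ofʸ ()
... | true  | ofʸ refl | false | _        | false | _        | false | _        = m∸n+n≡m+0 h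
... | false | _        | true  | ofʸ refl | true  | ofʸ ()   | _     | _
... | false | _        | true  | ofʸ refl | false | _        | true  | ofʸ ()
... | false | _        | true  | ofʸ refl | false | _        | false | _        = 1+m+0≡m+1 (s j)
... | false | _        | false | _        | true  | ofʸ refl | true  | ofʸ ()
... | false | _        | false | _        | true  | ofʸ refl | false | _        = +-assoc (s j) (1 + m) 0
... | false | _        | false | _        | false | _        | true  | ofʸ refl = 1+m+0≡m+1 (s j)
... | false | _        | false | _        | false | _        | false | _        = refl

weightedSum-replace : ∀ w L {s t c d : State} → t ⊕ c ≗ s ⊕ d →
  weightedSum w L t + weightedSum w L c ≡ weightedSum w L s + weightedSum w L d
weightedSum-replace w L {s} {t} {c} {d} t⊕c≗s⊕d = begin
  weightedSum w L t + weightedSum w L c ≡⟨ weightedSum-⊕ w L t c ⟨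
  weightedSum w L (t ⊕ c)               ≡⟨ weightedSum-cong w L (λ {j} _ → cong (w j *_) (t⊕c≗s⊕d j)) ⟩
  weightedSum w L (s ⊕ d)               ≡⟨ weightedSum-⊕ w L s d ⟩
  weightedSum w L s + weightedSum w L d ∎
  where open ≡-Reasoning

maxIndex : ∀ {k s t} → Move k s t → ℕ
maxIndex (comb1 _)       = 2
maxIndex (combI i _ _ _) = suc i
maxIndex (split2′ _)     = 3
maxIndex (splitI′ i _ _) = suc i

runMaxIndex : ∀ {s u ks} → Run s u ks → ℕ
runMaxIndex done        = 0
runMaxIndex (step mv r) = maxIndex mv ⊔ runMaxIndex r

⊔-<ˡ : ∀ {m n L} → m ⊔ n < L → m < L
⊔-<ˡ {m} {n} = ≤-<-trans (m≤m⊔n m n)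

⊔-<ʳ : ∀ {m n L} → m ⊔ n < L → n < L
⊔-<ʳ {m} {n} = ≤-<-trans (m≤n⊔m m n)

gain : ℕ → Kind → ℕ
gain c combining = c
gain c splitting = 0

-- A combining move raises Σ w_j s_j by c, a splitting move keeps it.
record Potential (c : ℕ) (w : ℕ → ℕ) : Set where
  field
    combine-1 : w 1 * 2 + c ≡ w 2
    combine-i : ∀ i → 2 ≤ i → w (i ∸ 1) + w i * i + c ≡ w (suc i)
    split-2   : w 2 * 3 ≡ w 1 + w 3
    split-i   : ∀ i → 3 ≤ i → w i * suc i ≡ w (suc i) + (w (i ∸ 1) * (i ∸ 2) + w (i ∸ 2))

module _ {c w} (P : Potential c w) {L : ℕ} where
  open Potential P

  private
    below : ∀ {i} → suc i < L → ∀ d → i ∸ d < L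
    below {i} 1+i<L d = ≤-<-trans (≤-trans (m∸n≤m i d) (n≤1+n i)) 1+i<L

    single-1 : ∀ {p} → p < L → weightedSum w L (single p 1) ≡ w p
    single-1 p<L = trans (weightedSum-single w 1 p<L) (*-identityʳ _)

    ⊕-values : ∀ {s t x y} → weightedSum w L s ≡ x → weightedSum w L t ≡ y →
               weightedSum w L (s ⊕ t) ≡ x + y
    ⊕-values {s} {t} eqₛ eqₜ = trans (weightedSum-⊕ w L s t) (cong₂ _+_ eqₛ eqₜ)

    rearrange : ∀ {X Y A R d} → X ≡ A → Y ≡ R → R + d ≡ A → X ≡ d + Y
    rearrange {R = R} {d} refl refl R+d≡A = trans (sym R+d≡A) (+-comm R d)

  weightedSum-exchange : ∀ {k s t} (mv : Move k s t) → maxIndex mv < L →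
    weightedSum w L (added mv) ≡ gain c k + weightedSum w L (removed mv)
  weightedSum-exchange (comb1 _) max<L =
    rearrange (single-1 max<L) (weightedSum-single w 2 (below max<L 0)) combine-1
  weightedSum-exchange (combI i 2≤i _ _) max<L =
    rearrange (single-1 max<L)
              (⊕-values (single-1 (below max<L 1)) (weightedSum-single w i (below max<L 0)))
              (combine-i i 2≤i)
  weightedSum-exchange (split2′ _) max<L =
    rearrange (⊕-values (single-1 (below max<L 1)) (single-1 max<L))
              (weightedSum-single w 3 (below max<L 0))
              (trans (+-identityʳ _) split-2)
  weightedSum-exchange (splitI′ i 3≤i _) max<L =
    rearrange (⊕-values (single-1 max<L)
                        (⊕-values (weightedSum-single w (i ∸ 2) (below max<L 1))
                                  (single-1 (below max<L 2))))
              (weightedSum-single w (suc i) (below max<L 0))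
              (trans (+-identityʳ _) (split-i i 3≤i))

  weightedSum-move : ∀ {k s t} (mv : Move k s t) → maxIndex mv < L →
    weightedSum w L t ≡ gain c k + weightedSum w L s
  weightedSum-move {k} {s} {t} mv max<L = +-cancelʳ-≡ (weightedSum w L (removed mv)) _ _ (begin
    weightedSum w L t + R         ≡⟨ weightedSum-replace w L (move-replaces mv) ⟩
    weightedSum w L s + A         ≡⟨ cong (weightedSum w L s +_) (weightedSum-exchange mv max<L) ⟩
    weightedSum w L s + (g + R)   ≡⟨ +-assoc (weightedSum w L s) g R ⟨
    weightedSum w L s + g + R     ≡⟨ cong (_+ R) (+-comm (weightedSum w L s) g) ⟩
    g + weightedSum w L s + R     ∎)
    where
    open ≡-Reasoning
    g R A : ℕ
    g = gain c k
    R = weightedSum w L (removed mv)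
    A = weightedSum w L (added mv)

  weightedSum-run : ∀ {s u ks} (r : Run s u ks) → runMaxIndex r < L →
    weightedSum w L u ≡ combiningCount ks * c + weightedSum w L s
  weightedSum-run done _ = refl
  weightedSum-run (step {k = splitting} {ks} mv r) max<L =
    trans (weightedSum-run r (⊔-<ʳ max<L)) (cong (combiningCount ks * c +_) (weightedSum-move mv (⊔-<ˡ max<L)))
  weightedSum-run {s} {u} (step {t = t} {k = combining} {ks} mv r) max<L = begin
    weightedSum w L u                    ≡⟨ weightedSum-run r (⊔-<ʳ max<L) ⟩
    n * c + weightedSum w L t            ≡⟨ cong (n * c +_) (weightedSum-move mv (⊔-<ˡ max<L)) ⟩
    n * c + (c + weightedSum w L s)      ≡⟨ +-assoc (n * c) c _ ⟨
    n * c + c + weightedSum w L s        ≡⟨ cong (_+ weightedSum w L s) (+-comm (n * c) c) ⟩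
    c + n * c + weightedSum w L s        ∎
    where
    open ≡-Reasoning
    n : ℕ
    n = combiningCount ks

a-potential : Potential 0 a
a-potential = record
  { combine-1 = refl
  ; combine-i = λ { (suc (suc m)) (s≤s (s≤s z≤n)) → combine (a (suc m)) (a (2 + m)) m }
  ; split-2   = refl
  ; split-i   = λ { (suc (suc (suc m))) (s≤s (s≤s (s≤s z≤n))) → split (a (suc m)) (a (2 + m)) m }
  }
  where
  combine : ∀ A₁ A₂ m → A₁ + A₂ * (2 + m) + 0 ≡ (2 + m) * A₂ + A₁
  combine = solve-∀
  split : ∀ A₁ A₂ m → ((2 + m) * A₂ + A₁) * (4 + m) ≡
          ((3 + m) * ((2 + m) * A₂ + A₁) + A₂) + (A₂ * (1 + m) + A₁)
  split = solve-∀

-- Building one a_(i+1) from i copies of a_i and one a_(i-1) takes one more combining move.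
combiningCost : ℕ → ℕ
combiningCost 0 = 0
combiningCost 1 = 0
combiningCost 2 = 1
combiningCost (suc (suc (suc i))) = suc (suc i) * combiningCost (suc (suc i)) + combiningCost (suc i) + 1

combiningCost-potential : Potential 1 combiningCost
combiningCost-potential = record
  { combine-1 = refl
  ; combine-i = λ { (suc (suc m)) (s≤s (s≤s z≤n)) → combine (combiningCost (suc m)) (combiningCost (2 + m)) m }
  ; split-2   = refl
  ; split-i   = λ { (suc (suc (suc m))) (s≤s (s≤s (s≤s z≤n))) → split (combiningCost (suc m)) (combiningCost (2 + m)) m }
  }
  where
  combine : ∀ B₁ B₂ m → B₁ + B₂ * (2 + m) + 1 ≡ (2 + m) * B₂ + B₁ + 1
  combine = solve-∀
  split : ∀ B₁ B₂ m → ((2 + m) * B₂ + B₁ + 1) * (4 + m) ≡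
          ((3 + m) * ((2 + m) * B₂ + B₁ + 1) + B₂ + 1) + (B₂ * (1 + m) + B₁)
  split = solve-∀

record Normal (u : State) : Set where
  field
    digit-≤        : ∀ i → u (suc i) ≤ suc i
    maximal⇒previous-0 : ∀ i → suc (suc i) ≤ u (suc (suc i)) → u (suc i) ≡ 0

terminal⇒normal : ∀ {u} → Terminal u → Normal u
terminal⇒normal {u} stuck = record { digit-≤ = digit-≤ ; maximal⇒previous-0 = maximal⇒previous-0 }
  where
  digit-≤ : ∀ i → u (suc i) ≤ suc i
  digit-≤ 0             = ≮⇒≥ (stuck _ _ ∘ comb1)
  digit-≤ 1             = ≮⇒≥ (stuck _ _ ∘ split2′)
  digit-≤ (suc (suc i)) = ≮⇒≥ (stuck _ _ ∘ splitI′ (3 + i) (s≤s (s≤s (s≤s z≤n))))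

  maximal⇒previous-0 : ∀ i → suc (suc i) ≤ u (suc (suc i)) → u (suc i) ≡ 0
  maximal⇒previous-0 i full = n≤0⇒n≡0 (≮⇒≥ (stuck _ _ ∘ combI (2 + i) (s≤s (s≤s z≤n)) full))

positional-< : ∀ {A x y P} Q → P < A → x < y → A * x + P < A * y + Q
positional-< {A} {x} {y} {P} Q P<A x<y = begin-strict
  A * x + P   <⟨ +-monoʳ-< (A * x) P<A ⟩
  A * x + A   ≡⟨ +-comm (A * x) A ⟩
  A + A * x   ≡⟨ *-suc A x ⟨
  A * suc x   ≤⟨ *-monoʳ-≤ A x<y ⟩
  A * y       ≤⟨ m≤m+n (A * y) Q ⟩
  A * y + Q   ∎
  where open ≤-Reasoning

positional-≡ : ∀ {A x y P Q} → P < A → Q < A → A * x + P ≡ A * y + Q → x ≡ y × P ≡ Q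
positional-≡ {A} {x} {y} {P} {Q} P<A Q<A eq with <-cmp x y
... | tri< x<y _ _ = contradiction eq (<⇒≢ (positional-< Q P<A x<y))
... | tri> _ _ y<x = contradiction (sym eq) (<⇒≢ (positional-< P Q<A y<x))
... | tri≈ _ refl _ = refl , +-cancelˡ-≡ (A * x) P Q eq

a-recurrence : ∀ k → a (2 + k) * (2 + k) + a (1 + k) ≡ a (3 + k)
a-recurrence k = cong (_+ a (1 + k)) (*-comm (a (2 + k)) (2 + k))

normal-value-<-step : ∀ {u} → Normal u → ∀ k →
  weightedSum a (suc k) u < a (suc k) → weightedSum a (2 + k) u < a (2 + k) →
  weightedSum a (3 + k) u < a (3 + k)
normal-value-<-step {u} nu k ihₖ ihₖ₊₁ with u (2 + k) ≤? suc k
... | yes below-max =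
  <-≤-trans (positional-< (a (1 + k)) ihₖ₊₁ (s≤s below-max)) (≤-reflexive (a-recurrence k))
... | no  not-below = begin-strict
  a i * u i + (a (1 + k) * u (1 + k) + V)   ≡⟨ cong₂ (λ x y → a i * x + (a (1 + k) * y + V)) uᵢ≡i uₖ≡0 ⟩
  a i * i + (a (1 + k) * 0 + V)             ≡⟨ cong (λ x → a i * i + (x + V)) (*-zeroʳ (a (1 + k))) ⟩
  a i * i + V                               <⟨ +-monoʳ-< (a i * i) ihₖ ⟩
  a i * i + a (1 + k)                       ≡⟨ a-recurrence k ⟩
  a (suc i)                                 ∎
  where
  open ≤-Reasoning
  i V : ℕ
  i = 2 + k
  V = weightedSum a (suc k) u
  full : i ≤ u i
  full = ≰⇒> not-below
  uᵢ≡i : u i ≡ i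
  uᵢ≡i = ≤-antisym (Normal.digit-≤ nu (suc k)) full
  uₖ≡0 : u (1 + k) ≡ 0
  uₖ≡0 = Normal.maximal⇒previous-0 nu k full

normal-value-< : ∀ {u} → Normal u → ∀ k → weightedSum a (suc k) u < a (suc k)
normal-value-< nu 0 = s≤s z≤n
normal-value-< {u} nu 1 =
  s≤s (≤-trans (≤-reflexive (trans (+-identityʳ _) (+-identityʳ (u 1)))) (Normal.digit-≤ nu 0))
normal-value-< nu (suc (suc k)) = normal-value-<-step nu k (normal-value-< nu k) (normal-value-< nu (suc k))

normal-unique : ∀ {u v} → Normal u → Normal v → ∀ L → weightedSum a L u ≡ weightedSum a L v →
                ∀ {j} → suc j < L → u (suc j) ≡ v (suc j)
normal-unique nu nv (suc zero) _ (s≤s ())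
normal-unique {u} {v} nu nv (suc (suc k)) eq 1+j<L =
  [ normal-unique nu nv (suc k) lower-equal , (λ { refl → top-equal }) ] (m<1+n⇒m<n∨m≡n 1+j<L)
  where
  top-equal×lower-equal : u (suc k) ≡ v (suc k) × weightedSum a (suc k) u ≡ weightedSum a (suc k) v
  top-equal×lower-equal = positional-≡ (normal-value-< nu k) (normal-value-< nv k) eq
  top-equal : u (suc k) ≡ v (suc k)
  top-equal = proj₁ top-equal×lower-equal
  lower-equal : weightedSum a (suc k) u ≡ weightedSum a (suc k) v
  lower-equal = proj₂ top-equal×lower-equal

combiningCount≡combiningCost : ∀ {n u ks L} (r : Run (initial n) u ks) → runMaxIndex r < L → 1 < L →
  combiningCount ks ≡ weightedSum combiningCost L u
combiningCount≡combiningCost {n} {u} {ks} {L} r max<L 1<L = sym (begin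
  weightedSum combiningCost L u
    ≡⟨ weightedSum-run combiningCost-potential r max<L ⟩
  combiningCount ks * 1 + weightedSum combiningCost L (initial n)
    ≡⟨ cong₂ _+_ (*-identityʳ _) (weightedSum-single combiningCost n 1<L) ⟩
  combiningCount ks + 0
    ≡⟨ +-identityʳ _ ⟩
  combiningCount ks ∎)
  where open ≡-Reasoning

value-invariant : ∀ {s u ks L} (r : Run s u ks) → runMaxIndex r < L → weightedSum a L u ≡ weightedSum a L s
value-invariant {s} {ks = ks} {L} r max<L =
  trans (weightedSum-run a-potential r max<L) (cong (_+ weightedSum a L s) (*-zeroʳ (combiningCount ks)))

theorem6p5 : (n : ℕ) → n ≥ 1 → (ks₁ ks₂ : List Kind) →
    CompleteGame n ks₁ → CompleteGame n ks₂ →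
    combiningCount ks₁ ≡ combiningCount ks₂
theorem6p5 n _ ks₁ ks₂ (u₁ , r₁ , stuck₁) (u₂ , r₂ , stuck₂) = begin
  combiningCount ks₁              ≡⟨ combiningCount≡combiningCost r₁ max₁<L 1<L ⟩
  weightedSum combiningCost L u₁  ≡⟨ weightedSum-cong combiningCost L same-digit ⟩
  weightedSum combiningCost L u₂  ≡⟨ combiningCount≡combiningCost r₂ max₂<L 1<L ⟨
  combiningCount ks₂              ∎
  where
  open ≡-Reasoning
  L : ℕ
  L = 2 + (runMaxIndex r₁ ⊔ runMaxIndex r₂)
  1<L : 1 < L
  1<L = s≤s (s≤s z≤n)
  max₁<L : runMaxIndex r₁ < L
  max₁<L = s≤s (m≤n⇒m≤1+n (m≤m⊔n _ _))
  max₂<L : runMaxIndex r₂ < L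
  max₂<L = s≤s (m≤n⇒m≤1+n (m≤n⊔m _ _))
  same-value : weightedSum a L u₁ ≡ weightedSum a L u₂
  same-value = trans (value-invariant r₁ max₁<L) (sym (value-invariant r₂ max₂<L))
  same-digit : ∀ {j} → j < L → combiningCost j * u₁ j ≡ combiningCost j * u₂ j
  same-digit {zero}  _ = refl
  same-digit {suc j} 1+j<L = cong (combiningCost (suc j) *_)
    (normal-unique (terminal⇒normal stuck₁) (terminal⇒normal stuck₂) L same-value 1+j<L)
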